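{- Let $q\ge 3$, $3\le k<n-1$, and $V=\mathbb{F}_q^n$. For every $(k-1)$-dimensional subspace $X\subset V$ there exist $Z_1,Z_2\in\mathcal{C}(n,k)_q$ such that $X=Z_1\cap Z_2$ and each $Z_i$ contains an element of $\mathcal{C}(n,1)_q$.
   Context: $\mathbb{F}_q$ is the field with $q$ elements, $V=\mathbb{F}_q^n$, $C_i=\{x\in V:x_i=0\}$. $\mathcal{C}(n,m)_q$ is the set of $m$-dimensional subspaces of $V$ contained in no $C_i$; in particular $\mathcal{C}(n,1)_q$ consists of the $1$-dimensional subspaces spanned by vectors with all coordinates non-zero. -}

module Defs where

open import Level using (Level; _⊔_; suc)
open import Data.Nat using (ℕ; zero) renaming (suc to sucℕ)
open import Data.Fin using (Fin) renaming (zero to fzero; suc to fsuc)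
open import Data.Product using (Σ; ∃; _×_)
open import Relation.Nullary using (¬_)
open import Relation.Binary.PropositionalEquality using (_≡_)
open import Algebra.Bundles using (CommutativeRing)

IsField : ∀ {c ℓ} → CommutativeRing c ℓ → Set (c ⊔ ℓ)
IsField R = (¬ (1# ≈ 0#)) × (∀ x → ¬ (x ≈ 0#) → ∃ λ y → (x * y) ≈ 1#)
  where open CommutativeRing R

HasCard : ∀ {c ℓ} → CommutativeRing c ℓ → ℕ → Set (c ⊔ ℓ)
HasCard R q = Σ (Fin q → Carrier) λ e →
  (∀ i j → e i ≈ e j → i ≡ j) × (∀ x → ∃ λ i → e i ≈ x)
  where open CommutativeRing R

module LinAlg {c ℓ} (R : CommutativeRing c ℓ) where
  open CommutativeRing R

  Vec : ℕ → Set c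
  Vec n = Fin n → Carrier

  ∑ : ∀ {m} → (Fin m → Carrier) → Carrier
  ∑ {zero} f = 0#
  ∑ {sucℕ m} f = f fzero + ∑ (λ i → f (fsuc i))

  lincomb : ∀ {m n} → (Fin m → Carrier) → (Fin m → Vec n) → Vec n
  lincomb a B j = ∑ (λ i → a i * B i j)

  -- a subspace is represented as a predicate on vectors
  Pred : ℕ → Set (suc (c ⊔ ℓ))
  Pred n = Vec n → Set (c ⊔ ℓ)

  Span : ∀ {m n} → (Fin m → Vec n) → Pred n
  Span B v = ∃ λ a → ∀ j → v j ≈ lincomb a B j

  LinIndep : ∀ {m n} → (Fin m → Vec n) → Set (c ⊔ ℓ)
  LinIndep B = ∀ a → (∀ j → lincomb a B j ≈ 0#) → ∀ i → a i ≈ 0#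

  IsSubspaceOfDim : ∀ {n} → ℕ → Pred n → Set (c ⊔ ℓ)
  IsSubspaceOfDim {n} m X = Σ (Fin m → Vec n) λ B →
    LinIndep B × (∀ v → (X v → Span B v) × (Span B v → X v))

  -- X ⊆ C_i  where  C_i = { x : x_i = 0 }
  ⊆C : ∀ {n} → Pred n → Fin n → Set (c ⊔ ℓ)
  ⊆C X i = ∀ v → X v → v i ≈ 0#

  In𝒞 : ∀ {n} → ℕ → Pred n → Set (c ⊔ ℓ)
  In𝒞 m X = IsSubspaceOfDim m X × (∀ i → ¬ ⊆C X i)

  _⊆_ : ∀ {n} → Pred n → Pred n → Set (c ⊔ ℓ)
  X ⊆ Y = ∀ v → X v → Y v

  IsIntersection : ∀ {n} → Pred n → Pred n → Pred n → Set (c ⊔ ℓ)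
  IsIntersection X Z₁ Z₂ = ∀ v → (X v → Z₁ v × Z₂ v) × (Z₁ v × Z₂ v → X v)

-- Let B be a basis of X. Over a field with a scalar α ∉ {0, 1}, the all-ones vector
-- together with the vectors obtained from it by replacing one coordinate by α spans F^n,
-- so a family of fewer than n vectors fails to span one of them; each of these vectors
-- has all coordinates nonzero. Pick such w₁ ∉ ⟨B⟩ and then such w₂ ∉ ⟨w₁, B⟩. Then
-- Zᵢ = ⟨wᵢ, B⟩ is k-dimensional, lies in no Cⱼ, contains the line ⟨wᵢ⟩ ∈ 𝒞(n,1), and
-- Z₁ ∩ Z₂ = X because w₂ ∉ Z₁. Finiteness of F makes span membership decidable, which
-- turns "fails to span one of them" into an explicit choice; the dimension count is the
-- Steinitz exchange lemma.
module Submission where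

open import Defs
import Level
open import Data.Nat as ℕ using (ℕ; z≤n; s≤s)
import Data.Nat.Properties as ℕ
open import Data.Fin using (Fin; punchIn; _≟_) renaming (zero to fzero; suc to fsuc)
open import Data.Fin.Patterns using (0F; 1F; 2F)
open import Data.Fin.Properties using (any?; all?; ¬∀⟶∃¬; punchInᵢ≢i)
open import Data.Product using (Σ; ∃; _×_; _,_; proj₁; proj₂)
open import Data.Empty using (⊥-elim)
open import Data.Vec.Functional using (_∷_; []; tail; insertAt; removeAt; updateAt)
open import Data.Vec.Functional.Properties
  using (insertAt-lookup; insertAt-punchIn; updateAt-updates; updateAt-minimal)
open import Function using (id; _∘_)
open import Relation.Nullary using (¬_; yes; no)
open import Relation.Nullary.Decidable using (map′)
open import Relation.Binary.Definitions using (Decidable)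
import Relation.Unary as U
import Relation.Binary.PropositionalEquality as ≡
open import Algebra.Bundles using (CommutativeRing)

module _ {c ℓ} (F : CommutativeRing c ℓ) where
  open CommutativeRing F
  open LinAlg F
  open import Algebra.Properties.Ring ring
    using (-‿distribˡ-*; x[y-z]≈xy-xz; x∙y⁻¹≈ε⇒x≈y; \\-leftDividesˡ; \\-leftDividesʳ)
  open import Algebra.Properties.Semiring.Sum semiring
    using (sum; sum-cong-≋; sum-remove; sum-replicate-zero; ∑-distrib-+; *-distribˡ-sum; *-distribʳ-sum)
  open import Data.Vec.Functional.Relation.Binary.Equality.Setoid setoid using (_≋_)
  open import Relation.Binary.Reasoning.Setoid setoid

  ∑≡sum : ∀ {m} (f : Fin m → Carrier) → ∑ f ≡.≡ sum f
  ∑≡sum {ℕ.zero} f = ≡.refl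
  ∑≡sum {ℕ.suc m} f = ≡.cong (f fzero +_) (∑≡sum (tail f))

  module _ {m n} (B : Fin m → Vec n) where

    lincomb≈sum : ∀ a j → lincomb a B j ≈ sum (λ i → a i * B i j)
    lincomb≈sum a j = reflexive (∑≡sum (λ i → a i * B i j))

    lincomb-cong : ∀ {a b} → a ≋ b → lincomb a B ≋ lincomb b B
    lincomb-cong {a} {b} a≋b j = begin
      lincomb a B j             ≈⟨ lincomb≈sum a j ⟩
      sum (λ i → a i * B i j)   ≈⟨ sum-cong-≋ {m} (λ i → *-congʳ (a≋b i)) ⟩
      sum (λ i → b i * B i j)   ≈⟨ lincomb≈sum b j ⟨
      lincomb b B j             ∎

    lincomb-≈0 : ∀ a j → (∀ i → a i * B i j ≈ 0#) → lincomb a B j ≈ 0#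
    lincomb-≈0 a j terms≈0 = begin
      lincomb a B j             ≈⟨ lincomb≈sum a j ⟩
      sum (λ i → a i * B i j)   ≈⟨ sum-cong-≋ terms≈0 ⟩
      sum {m} (λ _ → 0#)        ≈⟨ sum-replicate-zero m ⟩
      0#                        ∎

    lincomb-+ : ∀ a b j → lincomb (λ i → a i + b i) B j ≈ lincomb a B j + lincomb b B j
    lincomb-+ a b j = begin
      lincomb (λ i → a i + b i) B j                    ≈⟨ lincomb≈sum _ j ⟩
      sum (λ i → (a i + b i) * B i j)                  ≈⟨ sum-cong-≋ {m} (λ i → distribʳ (B i j) (a i) (b i)) ⟩
      sum (λ i → a i * B i j + b i * B i j)            ≈⟨ ∑-distrib-+ {m} (λ i → a i * B i j) (λ i → b i * B i j) ⟩
      sum (λ i → a i * B i j) + sum (λ i → b i * B i j) ≈⟨ +-cong (lincomb≈sum a j) (lincomb≈sum b j) ⟨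
      lincomb a B j + lincomb b B j                    ∎

    lincomb-* : ∀ x a j → lincomb (λ i → x * a i) B j ≈ x * lincomb a B j
    lincomb-* x a j = begin
      lincomb (λ i → x * a i) B j    ≈⟨ lincomb≈sum _ j ⟩
      sum (λ i → (x * a i) * B i j)  ≈⟨ sum-cong-≋ {m} (λ i → *-assoc x (a i) (B i j)) ⟩
      sum (λ i → x * (a i * B i j))  ≈⟨ *-distribˡ-sum {m} x (λ i → a i * B i j) ⟨
      x * sum (λ i → a i * B i j)    ≈⟨ *-congˡ (lincomb≈sum a j) ⟨
      x * lincomb a B j              ∎

  lincomb-removeAt : ∀ {p n} (T : Fin (ℕ.suc p) → Vec n) a i j →
    lincomb a T j ≈ a i * T i j + lincomb (removeAt a i) (removeAt T i) j
  lincomb-removeAt T a i j = begin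
    lincomb a T j                                                 ≈⟨ lincomb≈sum T a j ⟩
    sum (λ l → a l * T l j)                                       ≈⟨ sum-remove {i = i} (λ l → a l * T l j) ⟩
    a i * T i j + sum (λ l → a (punchIn i l) * T (punchIn i l) j) ≈⟨ +-congˡ (lincomb≈sum (removeAt T i) (removeAt a i) j) ⟨
    a i * T i j + lincomb (removeAt a i) (removeAt T i) j         ∎

  lincomb-insertAt : ∀ {p n} (T : Fin (ℕ.suc p) → Vec n) b i x j →
    lincomb (insertAt b i x) T j ≈ x * T i j + lincomb b (removeAt T i) j
  lincomb-insertAt T b i x j = trans (lincomb-removeAt T (insertAt b i x) i j)
    (+-cong (*-congʳ (reflexive (insertAt-lookup b i x)))
            (lincomb-cong (removeAt T i) (λ l → reflexive (insertAt-punchIn b i x l)) j))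

  lincomb-shear : ∀ {p n} (U : Fin p → Vec n) (t : Vec n) (s b : Fin p → Carrier) j →
    lincomb b (λ l j → U l j + s l * t j) j ≈ lincomb b U j + sum (λ l → b l * s l) * t j
  lincomb-shear {p} U t s b j = begin
    lincomb b (λ l j → U l j + s l * t j) j
      ≈⟨ lincomb≈sum (λ l j → U l j + s l * t j) b j ⟩
    sum (λ l → b l * (U l j + s l * t j))
      ≈⟨ sum-cong-≋ {p} (λ l → distribˡ (b l) (U l j) (s l * t j)) ⟩
    sum (λ l → b l * U l j + b l * (s l * t j))
      ≈⟨ ∑-distrib-+ {p} (λ l → b l * U l j) (λ l → b l * (s l * t j)) ⟩
    sum (λ l → b l * U l j) + sum (λ l → b l * (s l * t j))
      ≈⟨ +-cong (lincomb≈sum U b j) (sum-cong-≋ {p} (λ l → *-assoc (b l) (s l) (t j))) ⟨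
    lincomb b U j + sum (λ l → (b l * s l) * t j)
      ≈⟨ +-congˡ (*-distribʳ-sum (t j) (λ l → b l * s l)) ⟨
    lincomb b U j + sum (λ l → b l * s l) * t j
      ∎

  LinIndep-shear : ∀ {p n} {T : Fin (ℕ.suc p) → Vec n} → LinIndep T → ∀ i (s : Fin p → Carrier) →
    LinIndep (λ l j → T (punchIn i l) j + s l * T i j)
  LinIndep-shear {T = T} indep i s b Σb≈0 l = begin
    b l                           ≡⟨ insertAt-punchIn b i A l ⟨
    insertAt b i A (punchIn i l)  ≈⟨ indep (insertAt b i A) Σa≈0 (punchIn i l) ⟩
    0#                            ∎
    where
    A : Carrier
    A = sum (λ l → b l * s l)

    Σa≈0 : ∀ j → lincomb (insertAt b i A) T j ≈ 0#
    Σa≈0 j = begin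
      lincomb (insertAt b i A) T j                            ≈⟨ lincomb-insertAt T b i A j ⟩
      A * T i j + lincomb b (removeAt T i) j                  ≈⟨ +-comm _ _ ⟩
      lincomb b (removeAt T i) j + A * T i j                  ≈⟨ lincomb-shear (removeAt T i) (T i) s b j ⟨
      lincomb b (λ l j → T (punchIn i l) j + s l * T i j) j  ≈⟨ Σb≈0 j ⟩
      0#                                                      ∎

  module _ {m n} {B : Fin m → Vec n} where

    Span-resp : ∀ {u v} → u ≋ v → Span B u → Span B v
    Span-resp u≋v (a , u≋Ba) = a , λ j → trans (sym (u≋v j)) (u≋Ba j)

    Span-zero : Span B (λ _ → 0#)
    Span-zero = (λ _ → 0#) , λ j → sym (lincomb-≈0 B _ j (λ i → zeroˡ (B i j)))

    Span-[]-⊆ : Span [] ⊆ Span B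
    Span-[]-⊆ u (_ , u≋0) = Span-resp (λ j → sym (u≋0 j)) Span-zero

    Span-lin : ∀ {u v} (u∈ : Span B u) (v∈ : Span B v) x y → Span B (λ j → x * u j + y * v j)
    Span-lin {u} {v} (a , u≋) (b , v≋) x y = (λ i → x * a i + y * b i) , λ j → begin
      x * u j + y * v j                                          ≈⟨ +-cong (*-congˡ (u≋ j)) (*-congˡ (v≋ j)) ⟩
      x * lincomb a B j + y * lincomb b B j                      ≈⟨ +-cong (lincomb-* B x a j) (lincomb-* B y b j) ⟨
      lincomb (λ i → x * a i) B j + lincomb (λ i → y * b i) B j  ≈⟨ lincomb-+ B (λ i → x * a i) (λ i → y * b i) j ⟨
      lincomb (λ i → x * a i + y * b i) B j                      ∎

  module _ {m n} {w : Vec n} {B : Fin m → Vec n} where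

    Span-here : Span (w ∷ B) w
    Span-here = (1# ∷ λ _ → 0#) , λ j → sym (begin
      1# * w j + lincomb (λ _ → 0#) B j  ≈⟨ +-cong (*-identityˡ (w j)) (lincomb-≈0 B _ j (λ i → zeroˡ (B i j))) ⟩
      w j + 0#                           ≈⟨ +-identityʳ (w j) ⟩
      w j                                ∎)

    Span-there : ∀ {v} → Span B v → Span (w ∷ B) v
    Span-there {v} (a , v≋) = (0# ∷ a) , λ j → begin
      v j                         ≈⟨ v≋ j ⟩
      lincomb a B j               ≈⟨ +-identityˡ _ ⟨
      0# + lincomb a B j          ≈⟨ +-congʳ (zeroˡ (w j)) ⟨
      0# * w j + lincomb a B j    ∎

    Span-drop-head : ∀ {v} (v∈ : Span (w ∷ B) v) → proj₁ v∈ fzero ≈ 0# → Span B v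
    Span-drop-head {v} (a , v≋) a₀≈0 = tail a , λ j → begin
      v j                                ≈⟨ v≋ j ⟩
      a fzero * w j + lincomb (tail a) B j ≈⟨ +-congʳ (trans (*-congʳ a₀≈0) (zeroˡ (w j))) ⟩
      0# + lincomb (tail a) B j          ≈⟨ +-identityˡ _ ⟩
      lincomb (tail a) B j               ∎

    Span-∷-⊆ : ∀ {p} {S : Fin p → Vec n} → Span S w → Span B ⊆ Span S → Span (w ∷ B) ⊆ Span S
    Span-∷-⊆ w∈S B⊆S u (a , u≋) =
      Span-resp (λ j → trans (+-congˡ (*-identityˡ _)) (sym (u≋ j)))
                (Span-lin w∈S (B⊆S _ (tail a , λ _ → refl)) (a fzero) 1#)

    Span-eliminate-head : ∀ {u t d} (u∈ : Span (w ∷ B) u) (t∈ : Span (w ∷ B) t) →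
      proj₁ t∈ fzero * d ≈ 1# → Span B (λ j → u j + - (proj₁ u∈ fzero * d) * t j)
    Span-eliminate-head {u} {d = d} u∈@(b , _) t∈@(a , _) a₀d≈1 =
      Span-resp (λ j → +-congʳ (*-identityˡ (u j)))
                (Span-drop-head (Span-lin {B = w ∷ B} u∈ t∈ 1# (- (b₀ * d))) head≈0)
      where
      b₀ a₀ : Carrier
      b₀ = b fzero
      a₀ = a fzero

      head≈0 : 1# * b₀ + - (b₀ * d) * a₀ ≈ 0#
      head≈0 = begin
        1# * b₀ + - (b₀ * d) * a₀  ≈⟨ +-cong (*-identityˡ b₀) (sym (-‿distribˡ-* (b₀ * d) a₀)) ⟩
        b₀ + - (b₀ * d * a₀)       ≈⟨ +-congˡ (-‿cong (*-assoc b₀ d a₀)) ⟩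
        b₀ + - (b₀ * (d * a₀))     ≈⟨ +-congˡ (-‿cong (*-congˡ (trans (*-comm d a₀) a₀d≈1))) ⟩
        b₀ + - (b₀ * 1#)           ≈⟨ +-congˡ (-‿cong (*-identityʳ b₀)) ⟩
        b₀ + - b₀                  ≈⟨ -‿inverseʳ b₀ ⟩
        0#                         ∎

    Span-exchange : ∀ {v d} (v∈ : Span (w ∷ B) v) → proj₁ v∈ fzero * d ≈ 1# → Span (v ∷ B) w
    Span-exchange {v} {d} (a , v≋) a₀d≈1 = (d ∷ λ i → - d * tail a i) , λ j → sym (begin
      d * v j + lincomb (λ i → - d * tail a i) B j  ≈⟨ +-cong (*-congˡ (v≋ j)) (lincomb-* B (- d) (tail a) j) ⟩
      d * (a₀ * w j + L j) + - d * L j             ≈⟨ +-congʳ (distribˡ d (a₀ * w j) (L j)) ⟩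
      (d * (a₀ * w j) + d * L j) + - d * L j       ≈⟨ +-assoc _ _ _ ⟩
      d * (a₀ * w j) + (d * L j + - d * L j)       ≈⟨ +-cong (*-assoc d a₀ (w j)) (distribʳ (L j) d (- d)) ⟨
      (d * a₀) * w j + (d + - d) * L j             ≈⟨ +-cong (*-congʳ (trans (*-comm d a₀) a₀d≈1)) (*-congʳ (-‿inverseʳ d)) ⟩
      1# * w j + 0# * L j                          ≈⟨ +-cong (*-identityˡ (w j)) (zeroˡ (L j)) ⟩
      w j + 0#                                     ≈⟨ +-identityʳ (w j) ⟩
      w j                                          ∎)
      where
      a₀ : Carrier
      a₀ = a fzero

      L : Vec n
      L = lincomb (tail a) B

  AllNonzero : ∀ {n} → Vec n → Set ℓ
  AllNonzero w = ∀ i → w i ≉ 0#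

  ContainsLineIn𝒞 : ∀ {n} → Pred n → Set (Level.suc (c Level.⊔ ℓ))
  ContainsLineIn𝒞 {n} Z = Σ (Pred n) λ L → In𝒞 1 L × L ⊆ Z

  In𝒞-Span-∷ : ∀ {m n} {w : Vec n} {B : Fin m → Vec n} →
    LinIndep (w ∷ B) → AllNonzero w → In𝒞 (ℕ.suc m) (Span (w ∷ B))
  In𝒞-Span-∷ {w = w} {B} indep w≉0 =
    ((w ∷ B) , indep , λ v → id , id) , λ i Z⊆Cᵢ → w≉0 i (Z⊆Cᵢ w Span-here)

  basis : ∀ {n} → Fin n → Vec n
  basis j = updateAt (λ _ → 0#) j (λ _ → 1#)

  lincomb-basis : ∀ {n} (a : Vec n) j → lincomb a basis j ≈ a j
  lincomb-basis {ℕ.suc n} a j = begin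
    lincomb a basis j                                              ≈⟨ lincomb-removeAt basis a j j ⟩
    a j * basis j j + lincomb (removeAt a j) (removeAt basis j) j  ≈⟨ +-cong (*-congˡ (reflexive (updateAt-updates j _))) off-diagonal≈0 ⟩
    a j * 1# + 0#                                                  ≈⟨ +-identityʳ _ ⟩
    a j * 1#                                                       ≈⟨ *-identityʳ (a j) ⟩
    a j                                                            ∎
    where
    off-diagonal≈0 : lincomb (removeAt a j) (removeAt basis j) j ≈ 0#
    off-diagonal≈0 = lincomb-≈0 (removeAt basis j) _ j λ l →
      trans (*-congˡ (reflexive (updateAt-minimal j (punchIn j l) _ (punchInᵢ≢i j l ∘ ≡.sym)))) (zeroʳ _)

  basis-indep : ∀ {n} → LinIndep (basis {n})
  basis-indep a Σa≈0 i = trans (sym (lincomb-basis a i)) (Σa≈0 i)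

  HasCard⇒≈-dec : ∀ {q} → HasCard F q → Decidable _≈_
  HasCard⇒≈-dec (e , e-inj , e-surj) x y with e-surj x | e-surj y
  ... | i , eᵢ≈x | j , eⱼ≈y =
    map′ (λ { ≡.refl → trans (sym eᵢ≈x) eⱼ≈y })
         (λ x≈y → e-inj i j (trans eᵢ≈x (trans x≈y (sym eⱼ≈y))))
         (i ≟ j)

  module _ (_≈?_ : Decidable _≈_) where

    ∃-avoiding-two : ∀ {x y z} → x ≉ y → x ≉ z → y ≉ z → ∀ a b → ∃ λ u → u ≉ a × u ≉ b
    ∃-avoiding-two {x} {y} {z} x≉y x≉z y≉z a b with x ≈? a | x ≈? b
    ... | no x≉a | no x≉b = x , x≉a , x≉b
    ... | yes x≈a | _ with y ≈? b
    ...   | no y≉b  = y , (λ y≈a → x≉y (trans x≈a (sym y≈a))) , y≉b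
    ...   | yes y≈b = z , (λ z≈a → x≉z (trans x≈a (sym z≈a))) , (λ z≈b → y≉z (trans y≈b (sym z≈b)))
    ∃-avoiding-two {x} {y} {z} x≉y x≉z y≉z a b | no _ | yes x≈b with y ≈? a
    ...   | no y≉a  = y , y≉a , (λ y≈b → x≉y (trans x≈b (sym y≈b)))
    ...   | yes y≈a = z , (λ z≈a → y≉z (trans y≈a (sym z≈a))) , (λ z≈b → x≉z (trans x≈b (sym z≈b)))

    HasCard⇒∃≉0,1 : ∀ {q} → HasCard F q → 3 ℕ.≤ q → ∃ λ α → α ≉ 0# × α ≉ 1#
    HasCard⇒∃≉0,1 (e , e-inj , _) (s≤s (s≤s (s≤s _))) =
      ∃-avoiding-two (e-distinct {0F} {1F} (λ ())) (e-distinct {0F} {2F} (λ ())) (e-distinct {1F} {2F} (λ ())) 0# 1#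
      where
      e-distinct : ∀ {i j} → i ≡.≢ j → e i ≉ e j
      e-distinct i≢j eᵢ≈eⱼ = i≢j (e-inj _ _ eᵢ≈eⱼ)

    module _ {q} (e : Fin q → Carrier) (e-surj : ∀ x → ∃ λ i → e i ≈ x) where

      Span? : ∀ {m n} (S : Fin m → Vec n) → U.Decidable (Span S)
      Span? {ℕ.zero} S v = map′ (λ v≈0 → (λ ()) , v≈0) proj₂ (all? (λ j → v j ≈? 0#))
      Span? {ℕ.suc m} S v =
        map′ (λ (x , b , rest≋) → (e x ∷ b) , λ j → trans (sym (\\-leftDividesˡ _ (v j))) (+-congˡ (rest≋ j)))
             (λ (a , v≋) → let x , eₓ≈a₀ = e-surj (a fzero) in x , tail a , λ j →
               trans (+-congˡ (trans (v≋ j) (+-congʳ (*-congʳ (sym eₓ≈a₀))))) (\\-leftDividesʳ _ _))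
             (any? (λ x → Span? (tail S) (λ j → - (e x * S fzero j) + v j)))

    module _ (isField : IsField F) where

      1≉0 : 1# ≉ 0#
      1≉0 = proj₁ isField

      inverse : ∀ x → x ≉ 0# → ∃ λ y → x * y ≈ 1#
      inverse = proj₂ isField

      LinIndep-∷ : ∀ {m n} {w : Vec n} {B : Fin m → Vec n} → LinIndep B → ¬ Span B w → LinIndep (w ∷ B)
      LinIndep-∷ {w = w} {B} indep w∉ a Σa≈0 = a≈0
        where
        0∈ : Span (w ∷ B) (λ _ → 0#)
        0∈ = a , λ j → sym (Σa≈0 j)

        a₀≈0 : a fzero ≈ 0#
        a₀≈0 with a fzero ≈? 0#
        ... | yes a₀≈0 = a₀≈0
        ... | no a₀≉0 =
          let d , a₀d≈1 = inverse _ a₀≉0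
          in ⊥-elim (w∉ (Span-∷-⊆ Span-zero (λ _ → id) w (Span-exchange 0∈ a₀d≈1)))

        a≈0 : ∀ i → a i ≈ 0#
        a≈0 fzero = a₀≈0
        a≈0 (fsuc i) = indep (tail a) (λ j → sym (proj₂ (Span-drop-head 0∈ a₀≈0) j)) i

      Span-∷-∩ : ∀ {m n} {w₁ w₂ v : Vec n} {B : Fin m → Vec n} →
        ¬ Span (w₁ ∷ B) w₂ → Span (w₁ ∷ B) v → Span (w₂ ∷ B) v → Span B v
      Span-∷-∩ {w₂ = w₂} w₂∉ v∈₁ v∈₂@(b , _) with b fzero ≈? 0#
      ... | yes b₀≈0 = Span-drop-head v∈₂ b₀≈0
      ... | no b₀≉0 =
        let d , b₀d≈1 = inverse _ b₀≉0
        in ⊥-elim (w₂∉ (Span-∷-⊆ {S = _ ∷ _} v∈₁ (λ _ → Span-there) w₂ (Span-exchange v∈₂ b₀d≈1)))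

      steinitz : ∀ {m p n} (S : Fin m → Vec n) (T : Fin p → Vec n) →
        (∀ i → Span S (T i)) → LinIndep T → p ℕ.≤ m
      steinitz {p = ℕ.zero} _ _ _ _ = z≤n
      steinitz {ℕ.zero} {ℕ.suc p} S T T⊆S indep = ⊥-elim (1≉0 (indep (1# ∷ λ _ → 0#) T₀≋0 fzero))
        where
        T₀≋0 : ∀ j → lincomb (1# ∷ λ _ → 0#) T j ≈ 0#
        T₀≋0 j = trans (sym (proj₂ (Span-here {w = T fzero} {B = tail T}) j)) (proj₂ (T⊆S fzero) j)
      steinitz {ℕ.suc m} {ℕ.suc p} S T T⊆S indep with all? (λ i → proj₁ (T⊆S i) fzero ≈? 0#)
      ... | yes heads≈0 =
        ℕ.m≤n⇒m≤1+n (steinitz (tail S) T (λ i → Span-drop-head {w = S fzero} (T⊆S i) (heads≈0 i)) indep)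
      ... | no ¬heads≈0 =
        let i , head≉0 = ¬∀⟶∃¬ _ _ (λ i → proj₁ (T⊆S i) fzero ≈? 0#) ¬heads≈0
            d , d-inverse = inverse _ head≉0
        in s≤s (steinitz (tail S) _
                 (λ l → Span-eliminate-head {w = S fzero} (T⊆S (punchIn i l)) (T⊆S i) d-inverse)
                 (LinIndep-shear {T = T} indep i (λ l → - (proj₁ (T⊆S (punchIn i l)) fzero * d))))

      ContainsLineIn𝒞-Span-∷ : ∀ {m n} {w : Vec (ℕ.suc n)} {B : Fin m → Vec (ℕ.suc n)} →
        AllNonzero w → ContainsLineIn𝒞 (Span (w ∷ B))
      ContainsLineIn𝒞-Span-∷ {w = w} {B} w≉0 =
        Span (w ∷ []) ,
        In𝒞-Span-∷ {B = []} (LinIndep-∷ {B = []} (λ _ _ ()) (λ (_ , w≋0) → w≉0 fzero (w≋0 fzero))) w≉0 ,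
        Span-∷-⊆ {B = []} {S = w ∷ B} Span-here (Span-[]-⊆ {B = w ∷ B})

      module _ {q} (e : Fin q → Carrier) (e-surj : ∀ x → ∃ λ i → e i ≈ x)
               (α : Carrier) (α≉0 : α ≉ 0#) (α≉1 : α ≉ 1#) where

        ones : ∀ {n} → Vec n
        ones _ = 1#

        ones[_]≔α : ∀ {n} → Fin n → Vec n
        ones[ j ]≔α = updateAt ones j (λ _ → α)

        AllNonzero-ones[]≔α : ∀ {n} (j : Fin n) → AllNonzero ones[ j ]≔α
        AllNonzero-ones[]≔α j i with i ≟ j
        ... | yes ≡.refl = α≉0 ∘ trans (reflexive (≡.sym (updateAt-updates i ones)))
        ... | no i≢j = 1≉0 ∘ trans (reflexive (≡.sym (updateAt-minimal i j ones i≢j)))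

        α-1≉0 : α - 1# ≉ 0#
        α-1≉0 = α≉1 ∘ x∙y⁻¹≈ε⇒x≈y α 1#

        β : Carrier
        β = proj₁ (inverse _ α-1≉0)

        basis-as-difference : ∀ {n} (j i : Fin n) → β * ones[ j ]≔α i + - β * 1# ≈ basis j i
        basis-as-difference j i with i ≟ j
        ... | yes ≡.refl = begin
          β * ones[ i ]≔α i + - β * 1#  ≡⟨ ≡.cong (λ x → β * x + - β * 1#) (updateAt-updates i ones) ⟩
          β * α + - β * 1#              ≈⟨ +-congˡ (-‿distribˡ-* β 1#) ⟨
          β * α - β * 1#                ≈⟨ x[y-z]≈xy-xz β α 1# ⟨
          β * (α - 1#)                  ≈⟨ *-comm β _ ⟩
          (α - 1#) * β                  ≈⟨ proj₂ (inverse _ α-1≉0) ⟩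
          1#                            ≡⟨ updateAt-updates i _ ⟨
          basis i i                     ∎
        ... | no i≢j = begin
          β * ones[ j ]≔α i + - β * 1#  ≡⟨ ≡.cong (λ x → β * x + - β * 1#) (updateAt-minimal i j ones i≢j) ⟩
          β * 1# + - β * 1#             ≈⟨ distribʳ 1# β (- β) ⟨
          (β + - β) * 1#                ≈⟨ *-congʳ (-‿inverseʳ β) ⟩
          0# * 1#                       ≈⟨ zeroˡ 1# ⟩
          0#                            ≡⟨ updateAt-minimal i j _ i≢j ⟨
          basis j i                     ∎

        Span-basis : ∀ {m n} {S : Fin m → Vec n} →
          Span S ones → (∀ j → Span S ones[ j ]≔α) → ∀ j → Span S (basis j)
        Span-basis ones∈ ones[]∈ j = Span-resp (basis-as-difference j) (Span-lin (ones[]∈ j) ones∈ β (- β))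

        ∃-AllNonzero-∉Span : ∀ {m n} → m ℕ.< n → (S : Fin m → Vec n) → ∃ λ w → AllNonzero w × ¬ Span S w
        ∃-AllNonzero-∉Span {n = n} m<n S with Span? e e-surj S ones
        ... | no ones∉ = ones , (λ _ → 1≉0) , ones∉
        ... | yes ones∈ =
          let j , ones[j]∉ = ¬∀⟶∃¬ n _ (λ j → Span? e e-surj S ones[ j ]≔α)
                (λ ones[]∈ → ℕ.<⇒≱ m<n (steinitz S basis (Span-basis ones∈ ones[]∈) basis-indep))
          in ones[ j ]≔α , AllNonzero-ones[]≔α j , ones[j]∉

        two-In𝒞-extensions : ∀ {m n} → ℕ.suc m ℕ.< n → (X : Pred n) → IsSubspaceOfDim m X →
          Σ (Pred n) λ Z₁ → Σ (Pred n) λ Z₂ →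
            In𝒞 (ℕ.suc m) Z₁ × In𝒞 (ℕ.suc m) Z₂ × IsIntersection X Z₁ Z₂ ×
            ContainsLineIn𝒞 Z₁ × ContainsLineIn𝒞 Z₂
        two-In𝒞-extensions {m} {ℕ.suc n} m+1<n X (B , indep , X⇔SpanB)
          with ∃-AllNonzero-∉Span (ℕ.<-trans (ℕ.n<1+n m) m+1<n) B
        ... | w₁ , w₁≉0 , w₁∉ with ∃-AllNonzero-∉Span m+1<n (w₁ ∷ B)
        ... | w₂ , w₂≉0 , w₂∉ =
          Span (w₁ ∷ B) , Span (w₂ ∷ B) ,
          In𝒞-Span-∷ (LinIndep-∷ indep w₁∉) w₁≉0 ,
          In𝒞-Span-∷ (LinIndep-∷ indep (w₂∉ ∘ Span-there)) w₂≉0 ,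
          (λ v → (λ v∈X → let v∈ = proj₁ (X⇔SpanB v) v∈X in Span-there v∈ , Span-there v∈) ,
                 (λ (v∈₁ , v∈₂) → proj₂ (X⇔SpanB v) (Span-∷-∩ w₂∉ v∈₁ v∈₂))) ,
          ContainsLineIn𝒞-Span-∷ w₁≉0 , ContainsLineIn𝒞-Span-∷ w₂≉0

open import Data.Nat using (ℕ; _≤_; _<_; _+_; _∸_)

lemma7 : ∀ {c ℓ} (F : CommutativeRing c ℓ) → IsField F →
    (q : ℕ) → HasCard F q → 3 ≤ q →
    (n k : ℕ) → 3 ≤ k → k + 1 < n →
    let open LinAlg F in
    (X : Pred n) → IsSubspaceOfDim (k ∸ 1) X →
    Σ (Pred n) λ Z₁ → Σ (Pred n) λ Z₂ →
      In𝒞 k Z₁ × In𝒞 k Z₂ × IsIntersection X Z₁ Z₂ ×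
      (Σ (Pred n) λ L → In𝒞 1 L × L ⊆ Z₁) ×
      (Σ (Pred n) λ L → In𝒞 1 L × L ⊆ Z₂)
lemma7 F isField q card@(e , _ , e-surj) 3≤q n (ℕ.suc k) (s≤s _) k+1<n X dimX
  with HasCard⇒∃≉0,1 F (HasCard⇒≈-dec F card) card 3≤q
... | α , α≉0 , α≉1 =
  two-In𝒞-extensions F (HasCard⇒≈-dec F card) isField e e-surj α α≉0 α≉1
    (ℕ.<-trans (ℕ.m<m+n (ℕ.suc k) (s≤s z≤n)) k+1<n) X dimX
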